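{- Let $t$ be a closed $\bar\beta_v$-normalizable term and $t_0$ its $\bar\beta_v$-normal form. For all reduction sequences $d\colon t\to_{\bar\beta_v}^* t_0$ and $d'\colon t\to_{\bar\beta_v}^* t_0$, one has $\mathrm{leng}_{\beta_v}(d)=\mathrm{leng}_{\beta_v}(d')$.
   Context: Terms: $t ::= x \mid \lambda x.t \mid tu$ up to $\alpha$-conversion; closed means no free variables; values are variables and abstractions. Balanced contexts: $B ::= [\cdot] \mid (\lambda x.B)t \mid Bt \mid tB$. Root rule $(\lambda x.t)v \mapsto_{\beta_v} t\{v/x\}$ for $v$ a value; $\to_{\bar\beta_v}$ is its closure under balanced contexts. For a reduction sequence $d$, $\mathrm{leng}_{\beta_v}(d)$ is the number of $\bar\beta_v$-steps in $d$ (here, its length). -}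

module Defs where

open import Data.Nat using (ℕ; zero; suc)
open import Data.Fin using (Fin; zero; suc)
open import Relation.Nullary using (¬_)
open import Data.Product using (∃; _×_)

-- Lambda terms, well-scoped de Bruijn representation (terms with free
-- variables among n); this is terms up to alpha-conversion.
data Term (n : ℕ) : Set where
  var : Fin n → Term n
  ƛ_  : Term (suc n) → Term n
  _·_ : Term n → Term n → Term n

infixl 7 _·_

Closed : Set
Closed = Term 0

data Value {n : ℕ} : Term n → Set where
  v-var : (x : Fin n) → Value (var x)
  v-lam : (t : Term (suc n)) → Value (ƛ t)

Ren : ℕ → ℕ → Set
Ren m n = Fin m → Fin n

ext : ∀ {m n} → Ren m n → Ren (suc m) (suc n)
ext ρ zero    = zero
ext ρ (suc x) = suc (ρ x)

rename : ∀ {m n} → Ren m n → Term m → Term n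
rename ρ (var x) = var (ρ x)
rename ρ (ƛ t)   = ƛ rename (ext ρ) t
rename ρ (t · u) = rename ρ t · rename ρ u

Sub : ℕ → ℕ → Set
Sub m n = Fin m → Term n

exts : ∀ {m n} → Sub m n → Sub (suc m) (suc n)
exts σ zero    = var zero
exts σ (suc x) = rename suc (σ x)

subst : ∀ {m n} → Sub m n → Term m → Term n
subst σ (var x) = σ x
subst σ (ƛ t)   = ƛ subst (exts σ) t
subst σ (t · u) = subst σ t · subst σ u

_[_] : ∀ {n} → Term (suc n) → Term n → Term n
t [ v ] = subst σ t
  where
  σ : Sub _ _
  σ zero    = v
  σ (suc x) = var x

-- One-step β_v reduction closed under balanced contexts
-- B ::= [·] | (λx.B)t | B t | t B
data _⟶_ {n : ℕ} : Term n → Term n → Set where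
  βv    : ∀ {t : Term (suc n)} {v : Term n} → Value v → ((ƛ t) · v) ⟶ (t [ v ])
  ξ-lam : ∀ {t t' : Term (suc n)} {u : Term n} → t ⟶ t' → ((ƛ t) · u) ⟶ ((ƛ t') · u)
  ξ-l   : ∀ {t t' u : Term n} → t ⟶ t' → (t · u) ⟶ (t' · u)
  ξ-r   : ∀ {t u u' : Term n} → u ⟶ u' → (t · u) ⟶ (t · u')

infix 4 _⟶_ _⟶*_

data _⟶*_ {n : ℕ} : Term n → Term n → Set where
  ε   : ∀ {t} → t ⟶* t
  _◅_ : ∀ {t u w} → t ⟶ u → u ⟶* w → t ⟶* w

infixr 5 _◅_

leng : ∀ {n} {t u : Term n} → t ⟶* u → ℕ
leng ε       = zero
leng (_ ◅ d) = suc (leng d)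

Normal : ∀ {n} → Term n → Set
Normal t = ∀ {u} → ¬ (t ⟶ u)

IsNormalFormOf : ∀ {n} → Term n → Term n → Set
IsNormalFormOf t₀ t = (t ⟶* t₀) × Normal t₀

Normalizable : ∀ {n} → Term n → Set
Normalizable t = ∃ λ t₀ → IsNormalFormOf t₀ t

-- One-step reduction is quasi-diamond: two different steps out of a term can
-- be joined by one further step on each side. Balanced contexts never reduce
-- under an unapplied λ, so values are normal and the only critical pair is a
-- βv-redex whose body reduces; it closes because substituting a value commutes
-- with reduction. Quasi-diamond makes every step towards a normal form use up
-- exactly one step of any sequence to that normal form, so all such sequences
-- have the same length.
module Submission where

open import Defs
open import Relation.Binary.PropositionalEquality
  using (_≡_; _≗_; refl; cong; cong₂; sym; trans)
  renaming (subst to ≡-subst)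
open import Data.Nat using (suc)
open import Data.Fin using (zero; suc)
open import Data.Product using (Σ; _×_; _,_)
open import Data.Sum using (_⊎_; inj₁; inj₂)
open import Data.Empty using (⊥-elim)
open import Function using (_∘_)

ext-cong : ∀ {m n} {ρ ρ' : Ren m n} → ρ ≗ ρ' → ext ρ ≗ ext ρ'
ext-cong e zero    = refl
ext-cong e (suc x) = cong suc (e x)

rename-cong : ∀ {m n} {ρ ρ' : Ren m n} → ρ ≗ ρ' → (t : Term m) → rename ρ t ≡ rename ρ' t
rename-cong e (var x) = cong var (e x)
rename-cong e (ƛ t)   = cong ƛ_ (rename-cong (ext-cong e) t)
rename-cong e (t · u) = cong₂ _·_ (rename-cong e t) (rename-cong e u)

exts-cong : ∀ {m n} {σ σ' : Sub m n} → σ ≗ σ' → exts σ ≗ exts σ'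
exts-cong e zero    = refl
exts-cong e (suc x) = cong (rename suc) (e x)

subst-cong : ∀ {m n} {σ σ' : Sub m n} → σ ≗ σ' → (t : Term m) → subst σ t ≡ subst σ' t
subst-cong e (var x) = e x
subst-cong e (ƛ t)   = cong ƛ_ (subst-cong (exts-cong e) t)
subst-cong e (t · u) = cong₂ _·_ (subst-cong e t) (subst-cong e u)

rename-∘ : ∀ {l m n} (ρ' : Ren m n) (ρ : Ren l m) (t : Term l)
  → rename ρ' (rename ρ t) ≡ rename (ρ' ∘ ρ) t
rename-∘ ρ' ρ (var x) = refl
rename-∘ ρ' ρ (ƛ t)   = cong ƛ_ (trans (rename-∘ (ext ρ') (ext ρ) t)
  (rename-cong (λ { zero → refl ; (suc x) → refl }) t))
rename-∘ ρ' ρ (t · u) = cong₂ _·_ (rename-∘ ρ' ρ t) (rename-∘ ρ' ρ u)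

subst-rename : ∀ {l m n} (σ : Sub m n) (ρ : Ren l m) (t : Term l)
  → subst σ (rename ρ t) ≡ subst (σ ∘ ρ) t
subst-rename σ ρ (var x) = refl
subst-rename σ ρ (ƛ t)   = cong ƛ_ (trans (subst-rename (exts σ) (ext ρ) t)
  (subst-cong (λ { zero → refl ; (suc x) → refl }) t))
subst-rename σ ρ (t · u) = cong₂ _·_ (subst-rename σ ρ t) (subst-rename σ ρ u)

rename-subst : ∀ {l m n} (ρ : Ren m n) (σ : Sub l m) (t : Term l)
  → rename ρ (subst σ t) ≡ subst (rename ρ ∘ σ) t
rename-subst ρ σ (var x) = refl
rename-subst ρ σ (ƛ t)   = cong ƛ_ (trans (rename-subst (ext ρ) (exts σ) t)
  (subst-cong (λ { zero    → refl
                 ; (suc x) → trans (rename-∘ (ext ρ) suc (σ x)) (sym (rename-∘ suc ρ (σ x))) }) t))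
rename-subst ρ σ (t · u) = cong₂ _·_ (rename-subst ρ σ t) (rename-subst ρ σ u)

subst-∘ : ∀ {l m n} (τ : Sub m n) (σ : Sub l m) (t : Term l)
  → subst τ (subst σ t) ≡ subst (subst τ ∘ σ) t
subst-∘ τ σ (var x) = refl
subst-∘ τ σ (ƛ t)   = cong ƛ_ (trans (subst-∘ (exts τ) (exts σ) t)
  (subst-cong (λ { zero    → refl
                 ; (suc x) → trans (subst-rename (exts τ) suc (σ x)) (sym (rename-subst suc τ (σ x))) }) t))
subst-∘ τ σ (t · u) = cong₂ _·_ (subst-∘ τ σ t) (subst-∘ τ σ u)

subst-id : ∀ {n} {σ : Sub n n} → σ ≗ var → (t : Term n) → subst σ t ≡ t
subst-id e (var x) = e x
subst-id e (ƛ t)   = cong ƛ_ (subst-id (λ { zero → refl ; (suc x) → cong (rename suc) (e x) }) t)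
subst-id e (t · u) = cong₂ _·_ (subst-id e t) (subst-id e u)

subst-[] : ∀ {m n} (σ : Sub m n) (t : Term (suc m)) (v : Term m)
  → subst σ (t [ v ]) ≡ subst (exts σ) t [ subst σ v ]
subst-[] σ t v = trans (subst-∘ σ _ t) (trans
  (subst-cong (λ { zero    → refl
                 ; (suc x) → sym (trans (subst-rename _ suc (σ x)) (subst-id (λ _ → refl) (σ x))) }) t)
  (sym (subst-∘ _ (exts σ) t)))

ValueSub : ∀ {m n} → Sub m n → Set
ValueSub σ = ∀ x → Value (σ x)

rename-value : ∀ {m n} (ρ : Ren m n) {v : Term m} → Value v → Value (rename ρ v)
rename-value ρ (v-var x) = v-var (ρ x)
rename-value ρ (v-lam t) = v-lam (rename (ext ρ) t)

subst-value : ∀ {m n} {σ : Sub m n} → ValueSub σ → {v : Term m} → Value v → Value (subst σ v)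
subst-value vσ (v-var x) = vσ x
subst-value vσ (v-lam t) = v-lam _

exts-value : ∀ {m n} {σ : Sub m n} → ValueSub σ → ValueSub (exts σ)
exts-value vσ zero    = v-var zero
exts-value vσ (suc x) = rename-value suc (vσ x)

subst-⟶ : ∀ {m n} {σ : Sub m n} → ValueSub σ → {t t' : Term m} → t ⟶ t' → subst σ t ⟶ subst σ t'
subst-⟶ {σ = σ} vσ (βv {t = t} {v = v} val) =
  ≡-subst ((ƛ subst (exts σ) t) · subst σ v ⟶_) (sym (subst-[] σ t v)) (βv (subst-value vσ val))
subst-⟶ vσ (ξ-lam s) = ξ-lam (subst-⟶ (exts-value vσ) s)
subst-⟶ vσ (ξ-l s)   = ξ-l (subst-⟶ vσ s)
subst-⟶ vσ (ξ-r s)   = ξ-r (subst-⟶ vσ s)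

[]-⟶ : ∀ {n} {t t' : Term (suc n)} {v : Term n} → Value v → t ⟶ t' → t [ v ] ⟶ t' [ v ]
[]-⟶ val = subst-⟶ λ { zero → val ; (suc x) → v-var x }

value-normal : ∀ {n} {v : Term n} → Value v → Normal v
value-normal (v-var x) ()
value-normal (v-lam t) ()

Joinable : ∀ {n} → Term n → Term n → Set
Joinable {n} a b = a ≡ b ⊎ Σ (Term n) λ c → (a ⟶ c) × (b ⟶ c)

quasi-diamond : ∀ {n} {t a b : Term n} → t ⟶ a → t ⟶ b → Joinable a b
quasi-diamond (βv _)    (βv _)    = inj₁ refl
quasi-diamond (βv v)    (ξ-lam s) = inj₂ (_ , []-⟶ v s , βv v)
quasi-diamond (βv v)    (ξ-r s)   = ⊥-elim (value-normal v s)
quasi-diamond (ξ-lam s) (βv v)    = inj₂ (_ , βv v , []-⟶ v s)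
quasi-diamond (ξ-lam s) (ξ-lam s') with quasi-diamond s s'
... | inj₁ refl            = inj₁ refl
... | inj₂ (_ , p , q)     = inj₂ (_ , ξ-lam p , ξ-lam q)
quasi-diamond (ξ-lam s) (ξ-r s')  = inj₂ (_ , ξ-r s' , ξ-lam s)
quasi-diamond (ξ-l s)   (ξ-l s')  with quasi-diamond s s'
... | inj₁ refl            = inj₁ refl
... | inj₂ (_ , p , q)     = inj₂ (_ , ξ-l p , ξ-l q)
quasi-diamond (ξ-l s)   (ξ-r s')  = inj₂ (_ , ξ-r s' , ξ-l s)
quasi-diamond (ξ-r s)   (βv v)    = ⊥-elim (value-normal v s)
quasi-diamond (ξ-r s)   (ξ-lam s') = inj₂ (_ , ξ-lam s' , ξ-r s)
quasi-diamond (ξ-r s)   (ξ-l s')  = inj₂ (_ , ξ-l s' , ξ-r s)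
quasi-diamond (ξ-r s)   (ξ-r s')  with quasi-diamond s s'
... | inj₁ refl            = inj₁ refl
... | inj₂ (_ , p , q)     = inj₂ (_ , ξ-r p , ξ-r q)

⟶*-normal-after-step : ∀ {n} {t s t₀ : Term n} → Normal t₀ → (d : t ⟶* t₀) → t ⟶ s
  → Σ (s ⟶* t₀) λ e → suc (leng e) ≡ leng d
⟶*-normal-after-step nf ε         st = ⊥-elim (nf st)
⟶*-normal-after-step nf (st' ◅ d) st with quasi-diamond st' st
... | inj₁ refl          = d , refl
... | inj₂ (_ , p , q) with ⟶*-normal-after-step nf d p
...   | e , eq = q ◅ e , cong suc eq

leng-⟶*-normal : ∀ {n} {t t₀ : Term n} → Normal t₀ → (d d' : t ⟶* t₀) → leng d ≡ leng d'
leng-⟶*-normal nf ε       ε        = refl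
leng-⟶*-normal nf ε       (s ◅ _)  = ⊥-elim (nf s)
leng-⟶*-normal nf (s ◅ d) d' with ⟶*-normal-after-step nf d' s
... | e , eq = trans (cong suc (leng-⟶*-normal nf d e)) eq

corollary6p2 : (t : Closed) → Normalizable t → (t₀ : Closed) → Normal t₀
    → (d d' : t ⟶* t₀) → leng d ≡ leng d'
corollary6p2 _ _ _ nf = leng-⟶*-normal nf
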